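{- Let $H$ be an $(8,3)$-bigraph. If $M$ is a 1-factor in $H$, then there exists $M'\subseteq M$ with $|M'|\ge 6$ such that for each $e\in M'$, the graph $H-e$ contains a 1-factor.
   Context: A bigraph is a bipartite graph with parts $A$ and $B$ such that $|A|=|B|$; an $(s,t)$-bigraph is a bigraph with $|A|=|B|=s$ and minimum degree at least $t$. -}

module Defs where

open import Data.Nat using (ℕ; _≤_)
open import Data.Bool using (Bool; true; false; _∧_; not)
open import Data.Fin using (Fin; _≟_)
open import Data.Fin.Subset using (Subset; ∣_∣)
open import Data.Vec using (tabulate)
open import Data.Product using (Σ; _×_; _,_)
open import Data.Fin.Permutation using (Permutation′; _⟨$⟩ʳ_)
open import Relation.Nullary.Decidable using (⌊_⌋)
open import Relation.Binary.PropositionalEquality using (_≡_)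

-- A (simple) bigraph with parts A = Fin s and B = Fin s (so |A| = |B| = s).
-- adj a b = true  iff  a ∈ A is adjacent to b ∈ B.
record Bigraph (s : ℕ) : Set where
  field
    adj : Fin s → Fin s → Bool
open Bigraph public

degA : ∀ {s} → Bigraph s → Fin s → ℕ
degA H a = ∣ tabulate (λ b → adj H a b) ∣

degB : ∀ {s} → Bigraph s → Fin s → ℕ
degB H b = ∣ tabulate (λ a → adj H a b) ∣

MinDegAtLeast : ∀ {s} → Bigraph s → ℕ → Set
MinDegAtLeast H t = (∀ a → t ≤ degA H a) × (∀ b → t ≤ degB H b)

IsBigraph : (s t : ℕ) → Bigraph s → Set
IsBigraph s t H = MinDegAtLeast H t

_-ₑ_ : ∀ {s} → Bigraph s → Fin s × Fin s → Bigraph s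
adj (H -ₑ (a , b)) x y = adj H x y ∧ not (⌊ x ≟ a ⌋ ∧ ⌊ y ≟ b ⌋)

-- a 1-factor (perfect matching) of H: a bijection π : A → B such that
-- every pair (a , π a) is an edge of H; its edge set is {(a , π a) | a ∈ A}
OneFactor : ∀ {s} → Bigraph s → Set
OneFactor {s} H = Σ (Permutation′ s) λ π → ∀ a → adj H a (π ⟨$⟩ʳ a) ≡ true

edgeAt : ∀ {s} (H : Bigraph s) → OneFactor H → Fin s → Fin s × Fin s
edgeAt H (π , _) a = (a , π ⟨$⟩ʳ a)

module Submission where

-- Write M as a bijection π : A → B and put i ⟶ j when a_i is adjacent to π(a_j). This digraph
-- has a loop at every vertex and in- and out-degrees at least t; its cycles through a are the
-- M-alternating cycles through (a , π a), and rotating M along one gives a 1-factor of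
-- H - (a , π a). So it suffices that at most two vertices lie on no cycle of length ≥ 2. For such
-- a vertex x, the sets of vertices reachable from x and reaching x meet only in x and each has
-- more than t elements, which on s ≤ 2t + 2 vertices leaves room for at most one vertex
-- incomparable with x. An off-cycle descendant y of x has Reach y ⊂ Reach x, and among three
-- off-cycle vertices one always has either two off-cycle descendants or a descendant and an
-- incomparable vertex; either overflows that count.

open import Defs
open import Data.Bool using (Bool; true; false; T; if_then_else_)
open import Data.Bool.Properties using (T-≡; ∧-identityʳ)
open import Data.Empty using (⊥-elim) renaming (⊥ to ∅)
open import Data.Fin using (Fin; zero; suc; _≟_)
open import Data.Fin.Permutation as Perm using (Permutation′; _⟨$⟩ʳ_; _∘ₚ_; transpose)
import Data.Fin.Permutation.Components as PC
open import Data.Fin.Properties using (any?)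
open import Data.Fin.Subset
  using (Subset; inside; outside; ⊥; ⁅_⁆; _∈_; _∉_; _⊆_; _⊈_; _⊂_; _∪_; _∩_; _-_; ∁; ∣_∣)
open import Data.Fin.Subset.Properties
  using ( _∈?_; _⊆?_; ⊆-antisym; ∣p∣≤n; ∣⊥∣≡0; ∣⁅x⁆∣≡1; ∣∁p∣≡n∸∣p∣; p⊆q⇒∣p∣≤∣q∣; p⊂q⇒∣p∣<∣q∣
        ; x∈⁅x⁆; x∈⁅y⁆⇒x≡y; x∉⁅y⁆⇒x≢y; x∈p∪q⁺; x∈p∪q⁻; x∈p∩q⁺; x∈p∩q⁻; x∉∁p⇒x∈p; x∈∁p⇒x∉p
        ; x∈p∧x≢y⇒x∈p-y; x∈p⇒∣p-x∣<∣p∣)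
open import Data.Nat using (ℕ; zero; suc; _+_; _≤_; _<_; z≤n; s≤s)
open import Data.Nat.Properties
  using ( ≤-refl; ≤-trans; <-≤-trans; ≤-reflexive; <⇒≱; ≰⇒>; _≤?_; m≤m+n; m+[n∸m]≡n
        ; +-suc; +-comm; +-assoc; +-mono-≤; +-monoʳ-≤; +-cancelˡ-≤; +-cancelʳ-≤
        ; +-0-commutativeMonoid; module ≤-Reasoning)
open import Algebra.Properties.CommutativeMonoid.Sum +-0-commutativeMonoid using (sum; sum-permute)
open import Data.Product using (Σ; ∃; _×_; _,_; proj₁; proj₂; map₁; map₂)
open import Data.Sum using (_⊎_; inj₁; inj₂)
open import Data.Vec using (_∷_; []; tabulate)
open import Data.Vec.Properties using (lookup∘tabulate; []=⇒lookup; lookup⇒[]=)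
open import Function using (_∘_; id; flip)
open import Function.Bundles using (Injection; Equivalence)
open import Function.Properties.Inverse using (↔⇒↣)
open import Level using (Level; 0ℓ)
open import Relation.Binary using (Rel)
import Relation.Binary as B
open import Relation.Binary.Construct.Closure.ReflexiveTransitive using (Star; ε; _◅_; _◅◅_; reverse)
open import Relation.Binary.PropositionalEquality
  using (_≡_; _≢_; refl; sym; trans; cong; cong₂; subst; ≢-sym; module ≡-Reasoning)
open import Relation.Nullary using (yes; no; does; ¬_; contradiction)
open import Relation.Nullary.Decidable
  using (dec-true; dec-false; decidable-stable; map′; _×-dec_; _⊎-dec_; ¬?)
open import Relation.Nullary.Decidable.Core using (T?)
open import Relation.Unary using (Pred; Decidable)

private
  variable
    ℓ : Level
    n : ℕ

module _ {P : Pred (Fin n) ℓ} (P? : Decidable P) where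

  toSubset : Subset n
  toSubset = tabulate (does ∘ P?)

  ∈-toSubset⁺ : ∀ {x} → P x → x ∈ toSubset
  ∈-toSubset⁺ {x} px = lookup⇒[]= x toSubset (trans (lookup∘tabulate (does ∘ P?) x) (dec-true (P? x) px))

  ∈-toSubset⁻ : ∀ {x} → x ∈ toSubset → P x
  ∈-toSubset⁻ {x} x∈ with P? x | trans (sym (lookup∘tabulate (does ∘ P?) x)) ([]=⇒lookup x∈)
  ... | yes px | _  = px
  ... | no  _  | ()

∣p∪q∣+∣p∩q∣≡∣p∣+∣q∣ : ∀ (p q : Subset n) → ∣ p ∪ q ∣ + ∣ p ∩ q ∣ ≡ ∣ p ∣ + ∣ q ∣
∣p∪q∣+∣p∩q∣≡∣p∣+∣q∣ []            []            = refl
∣p∪q∣+∣p∩q∣≡∣p∣+∣q∣ (inside ∷ p)  (inside ∷ q)  = cong suc (begin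
  ∣ p ∪ q ∣ + suc ∣ p ∩ q ∣    ≡⟨ +-suc _ _ ⟩
  suc (∣ p ∪ q ∣ + ∣ p ∩ q ∣)  ≡⟨ cong suc (∣p∪q∣+∣p∩q∣≡∣p∣+∣q∣ p q) ⟩
  suc (∣ p ∣ + ∣ q ∣)          ≡⟨ +-suc _ _ ⟨
  ∣ p ∣ + suc ∣ q ∣            ∎)
  where open ≡-Reasoning
∣p∪q∣+∣p∩q∣≡∣p∣+∣q∣ (inside ∷ p)  (outside ∷ q) = cong suc (∣p∪q∣+∣p∩q∣≡∣p∣+∣q∣ p q)
∣p∪q∣+∣p∩q∣≡∣p∣+∣q∣ (outside ∷ p) (inside ∷ q)  = trans (cong suc (∣p∪q∣+∣p∩q∣≡∣p∣+∣q∣ p q)) (sym (+-suc _ _))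
∣p∪q∣+∣p∩q∣≡∣p∣+∣q∣ (outside ∷ p) (outside ∷ q) = ∣p∪q∣+∣p∩q∣≡∣p∣+∣q∣ p q

∣p∪q∣≤∣p∣+∣q∣ : ∀ (p q : Subset n) → ∣ p ∪ q ∣ ≤ ∣ p ∣ + ∣ q ∣
∣p∪q∣≤∣p∣+∣q∣ p q = ≤-trans (m≤m+n ∣ p ∪ q ∣ ∣ p ∩ q ∣) (≤-reflexive (∣p∪q∣+∣p∩q∣≡∣p∣+∣q∣ p q))

∣p∣+∣∁p∣≡n : ∀ (p : Subset n) → ∣ p ∣ + ∣ ∁ p ∣ ≡ n
∣p∣+∣∁p∣≡n p = trans (cong (∣ p ∣ +_) (∣∁p∣≡n∸∣p∣ p)) (m+[n∸m]≡n (∣p∣≤n p))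

x∈p⇒0<∣p∣ : ∀ {p : Subset n} {x} → x ∈ p → 0 < ∣ p ∣
x∈p⇒0<∣p∣ x∈p = ≤-trans (s≤s z≤n) (x∈p⇒∣p-x∣<∣p∣ x∈p)

x≢y⇒1<∣p∣ : ∀ {p : Subset n} {x y} → x ∈ p → y ∈ p → x ≢ y → 1 < ∣ p ∣
x≢y⇒1<∣p∣ x∈p y∈p x≢y = ≤-trans (s≤s (x∈p⇒0<∣p∣ (x∈p∧x≢y⇒x∈p-y y∈p (≢-sym x≢y)))) (x∈p⇒∣p-x∣<∣p∣ x∈p)

p⊈q⇒∃∈p∉q : ∀ {p q : Subset n} → p ⊈ q → ∃ λ x → x ∈ p × x ∉ q
p⊈q⇒∃∈p∉q {p = p} {q} p⊈q with any? (λ x → x ∈? p ×-dec ¬? (x ∈? q))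
... | yes witness = witness
... | no  none    = contradiction (λ {x} x∈p → decidable-stable (x ∈? q) (λ x∉q → none (x , x∈p , x∉q))) p⊈q

∣q∣<∣p∣⇒∃∈p∉q : ∀ {p q : Subset n} → ∣ q ∣ < ∣ p ∣ → ∃ λ x → x ∈ p × x ∉ q
∣q∣<∣p∣⇒∃∈p∉q q<p = p⊈q⇒∃∈p∉q (λ p⊆q → <⇒≱ q<p (p⊆q⇒∣p∣≤∣q∣ p⊆q))

no-three-distinct⇒∣p∣≤2 : ∀ {p : Subset n} →
  (∀ {x y z} → x ∈ p → y ∈ p → z ∈ p → x ≢ y → x ≢ z → y ≢ z → ∅) → ∣ p ∣ ≤ 2
no-three-distinct⇒∣p∣≤2 {n} {p} no-three with ∣ p ∣ ≤? 2
... | yes ∣p∣≤2 = ∣p∣≤2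
... | no  ∣p∣≰2 =
  let x , x∈p , _    = outside-of ⊥ (≤-trans (≤-reflexive (∣⊥∣≡0 n)) z≤n)
      y , y∈p , y∉x  = outside-of ⁅ x ⁆ (≤-trans (≤-reflexive (∣⁅x⁆∣≡1 x)) (s≤s z≤n))
      z , z∈p , z∉xy = outside-of (⁅ x ⁆ ∪ ⁅ y ⁆)
        (≤-trans (∣p∪q∣≤∣p∣+∣q∣ ⁅ x ⁆ ⁅ y ⁆) (≤-reflexive (cong₂ _+_ (∣⁅x⁆∣≡1 x) (∣⁅x⁆∣≡1 y))))
  in ⊥-elim (no-three x∈p y∈p z∈p (≢-sym (x∉⁅y⁆⇒x≢y y∉x))
       (≢-sym (x∉⁅y⁆⇒x≢y (z∉xy ∘ x∈p∪q⁺ ∘ inj₁))) (≢-sym (x∉⁅y⁆⇒x≢y (z∉xy ∘ x∈p∪q⁺ ∘ inj₂))))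
  where
  outside-of : ∀ q → ∣ q ∣ ≤ 2 → ∃ λ x → x ∈ p × x ∉ q
  outside-of q ∣q∣≤2 = ∣q∣<∣p∣⇒∃∈p∉q (≤-trans (s≤s ∣q∣≤2) (≰⇒> ∣p∣≰2))

∣tabulate∣≡sum : ∀ (f : Fin n → Bool) → ∣ tabulate f ∣ ≡ sum (λ i → if f i then 1 else 0)
∣tabulate∣≡sum {zero}  f = refl
∣tabulate∣≡sum {suc n} f with f zero
... | true  = cong suc (∣tabulate∣≡sum (f ∘ suc))
... | false = ∣tabulate∣≡sum (f ∘ suc)

∣tabulate∘permute∣≡∣tabulate∣ : ∀ (f : Fin n → Bool) (π : Permutation′ n) →
  ∣ tabulate (f ∘ (π ⟨$⟩ʳ_)) ∣ ≡ ∣ tabulate f ∣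
∣tabulate∘permute∣≡∣tabulate∣ f π = begin
  ∣ tabulate (f ∘ (π ⟨$⟩ʳ_)) ∣                ≡⟨ ∣tabulate∣≡sum (f ∘ (π ⟨$⟩ʳ_)) ⟩
  sum (λ i → if f (π ⟨$⟩ʳ i) then 1 else 0)  ≡⟨ sum-permute (λ i → if f i then 1 else 0) π ⟨
  sum (λ i → if f i then 1 else 0)            ≡⟨ ∣tabulate∣≡sum f ⟨
  ∣ tabulate f ∣                              ∎
  where open ≡-Reasoning

transpose-matchˡ : ∀ (i j : Fin n) → PC.transpose i j i ≡ j
transpose-matchˡ i j rewrite dec-true (i ≟ i) refl = refl

transpose-matchʳ : ∀ (i j : Fin n) → PC.transpose i j j ≡ i
transpose-matchʳ i j with j ≟ i
... | yes refl = refl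
... | no  _    rewrite dec-true (j ≟ j) refl = refl

transpose-mismatch : ∀ {i j k : Fin n} → k ≢ i → k ≢ j → PC.transpose i j k ≡ k
transpose-mismatch {i = i} {j} {k} k≢i k≢j rewrite dec-false (k ≟ i) k≢i | dec-false (k ≟ j) k≢j = refl

permutation-injective : ∀ (σ : Permutation′ n) {y z} → σ ⟨$⟩ʳ y ≡ σ ⟨$⟩ʳ z → y ≡ z
permutation-injective σ = Injection.injective (↔⇒↣ σ)

module Digraph {_⟶_ : Rel (Fin n) ℓ} (_⟶?_ : B.Decidable _⟶_) where

  _⟶*_ : Rel (Fin n) ℓ
  _⟶*_ = Star _⟶_

  Closed : Subset n → Set ℓ
  Closed S = ∀ {y z} → y ∈ S → y ⟶ z → z ∈ S

  closed-⟶* : ∀ {S x z} → Closed S → x ∈ S → x ⟶* z → z ∈ S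
  closed-⟶* closed x∈S ε        = x∈S
  closed-⟶* closed x∈S (e ◅ es) = closed-⟶* closed (closed x∈S e) es

  InOrAfter : Subset n → Pred (Fin n) ℓ
  InOrAfter S z = z ∈ S ⊎ ∃ λ y → y ∈ S × y ⟶ z

  inOrAfter? : ∀ S → Decidable (InOrAfter S)
  inOrAfter? S z = z ∈? S ⊎-dec any? (λ y → y ∈? S ×-dec y ⟶? z)

  grow : Subset n → Subset n
  grow S = toSubset (inOrAfter? S)

  ⊆-grow : ∀ {S} → S ⊆ grow S
  ⊆-grow {S} = ∈-toSubset⁺ (inOrAfter? S) ∘ inj₁

  ∈-grow : ∀ {S y z} → y ∈ S → y ⟶ z → z ∈ grow S
  ∈-grow {S} y∈S y⟶z = ∈-toSubset⁺ (inOrAfter? S) (inj₂ (_ , y∈S , y⟶z))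

  ∈-grow⁻ : ∀ {S z} → z ∈ grow S → InOrAfter S z
  ∈-grow⁻ {S} = ∈-toSubset⁻ (inOrAfter? S)

  grow-mono : ∀ {S T} → S ⊆ T → grow S ⊆ grow T
  grow-mono S⊆T z∈ with ∈-grow⁻ z∈
  ... | inj₁ z∈S             = ⊆-grow (S⊆T z∈S)
  ... | inj₂ (y , y∈S , y⟶z) = ∈-grow (S⊆T y∈S) y⟶z

  layer : Fin n → ℕ → Subset n
  layer x zero    = ⁅ x ⁆
  layer x (suc k) = grow (layer x k)

  x∈layer : ∀ x k → x ∈ layer x k
  x∈layer x zero    = x∈⁅x⁆ x
  x∈layer x (suc k) = ⊆-grow (x∈layer x k)

  ∈layer⇒⟶* : ∀ {x z} k → z ∈ layer x k → x ⟶* z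
  ∈layer⇒⟶* zero z∈ with x∈⁅y⁆⇒x≡y _ z∈
  ... | refl = ε
  ∈layer⇒⟶* (suc k) z∈ with ∈-grow⁻ z∈
  ... | inj₁ z∈L             = ∈layer⇒⟶* k z∈L
  ... | inj₂ (y , y∈L , y⟶z) = ∈layer⇒⟶* k y∈L ◅◅ y⟶z ◅ ε

  layer-stable-or-large : ∀ x k → grow (layer x k) ⊆ layer x k ⊎ k < ∣ layer x k ∣
  layer-stable-or-large x zero = inj₂ (≤-reflexive (sym (∣⁅x⁆∣≡1 x)))
  layer-stable-or-large x (suc k) with layer-stable-or-large x k
  ... | inj₁ stable = inj₁ (grow-mono stable)
  ... | inj₂ k<∣L∣ with grow (layer x k) ⊆? layer x k
  ...   | yes stable = inj₁ (grow-mono stable)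
  ...   | no  ¬stable = inj₂ (<-≤-trans (s≤s k<∣L∣) (p⊂q⇒∣p∣<∣q∣ (⊆-grow , p⊈q⇒∃∈p∉q ¬stable)))

  Reach : Fin n → Subset n
  Reach x = layer x n

  Reach-closed : ∀ {x} → Closed (Reach x)
  Reach-closed {x} y∈ y⟶z with layer-stable-or-large x n
  ... | inj₁ stable = stable (∈-grow y∈ y⟶z)
  ... | inj₂ n<∣L∣  = contradiction (∣p∣≤n (layer x n)) (<⇒≱ n<∣L∣)

  ⟶*⇒∈Reach : ∀ {x z} → x ⟶* z → z ∈ Reach x
  ⟶*⇒∈Reach {x} = closed-⟶* Reach-closed (x∈layer x n)

  ∈Reach⇒⟶* : ∀ {x z} → z ∈ Reach x → x ⟶* z
  ∈Reach⇒⟶* = ∈layer⇒⟶* n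

  reachable? : B.Decidable _⟶*_
  reachable? x z = map′ ∈Reach⇒⟶* ⟶*⇒∈Reach (z ∈? Reach x)

  module _ (loop : ∀ z → z ⟶ z) (x : Fin n) where

    -- σ advances every vertex of a walk from x to y by one step and sends y back to x.
    Rotation : Fin n → Subset n → Set ℓ
    Rotation y S = ∃ λ (σ : Permutation′ n) →
      σ ⟨$⟩ʳ y ≡ x × (∀ z → z ≢ y → z ⟶ (σ ⟨$⟩ʳ z)) × (∀ z → z ∉ S → σ ⟨$⟩ʳ z ≡ z)

    rotation-weaken : ∀ {y S T} → S ⊆ T → Rotation y S → Rotation y T
    rotation-weaken S⊆T (σ , σy≡x , σ-edges , σ-support) =
      σ , σy≡x , σ-edges , λ z z∉T → σ-support z (z∉T ∘ S⊆T)

    rotation-extend : ∀ {i y S T} → Rotation i S → x ∈ S → y ∉ S → i ⟶ y → S ⊆ T → y ∈ T → Rotation y T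
    rotation-extend {i} {y} {S} {T} (σ , σi≡x , σ-edges , σ-support) x∈S y∉S i⟶y S⊆T y∈T =
      τ , τy≡x , τ-edges , τ-support
      where
      τ : Permutation′ n
      τ = σ ∘ₚ transpose x y

      σy≡y : σ ⟨$⟩ʳ y ≡ y
      σy≡y = σ-support y y∉S

      τy≡x : τ ⟨$⟩ʳ y ≡ x
      τy≡x = trans (cong (PC.transpose x y) σy≡y) (transpose-matchʳ x y)

      τ-edges : ∀ z → z ≢ y → z ⟶ (τ ⟨$⟩ʳ z)
      τ-edges z z≢y with z ≟ i
      ... | yes refl = subst (z ⟶_) (sym (trans (cong (PC.transpose x y) σi≡x) (transpose-matchˡ x y))) i⟶y
      ... | no  z≢i  = subst (z ⟶_) (sym (transpose-mismatch σz≢x σz≢y)) (σ-edges z z≢i)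
        where
        σz≢x : σ ⟨$⟩ʳ z ≢ x
        σz≢x σz≡x = z≢i (permutation-injective σ (trans σz≡x (sym σi≡x)))
        σz≢y : σ ⟨$⟩ʳ z ≢ y
        σz≢y σz≡y = z≢y (permutation-injective σ (trans σz≡y (sym σy≡y)))

      τ-support : ∀ z → z ∉ T → τ ⟨$⟩ʳ z ≡ z
      τ-support z z∉T = trans (cong (PC.transpose x y) (σ-support z (z∉T ∘ S⊆T)))
        (transpose-mismatch (λ { refl → z∉T (S⊆T x∈S) }) (λ { refl → z∉T y∈T }))

    -- Following the layers, a vertex first reached in layer k + 1 lies outside the support of
    -- the rotation to its predecessor, as rotation-extend requires.
    rotation-layer : ∀ k {y} → y ∈ layer x k → Rotation y (layer x k)
    rotation-layer zero y∈ with x∈⁅y⁆⇒x≡y x y∈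
    ... | refl = Perm.id , refl , (λ z _ → loop z) , (λ _ _ → refl)
    rotation-layer (suc k) {y} y∈ with y ∈? layer x k | ∈-grow⁻ y∈
    ... | yes y∈L | _                    = rotation-weaken ⊆-grow (rotation-layer k y∈L)
    ... | no  y∉L | inj₁ y∈L             = contradiction y∈L y∉L
    ... | no  y∉L | inj₂ (i , i∈L , i⟶y) =
      rotation-extend (rotation-layer k i∈L) (x∈layer x k) y∉L i⟶y ⊆-grow y∈

    rotation : ∀ {y} → x ⟶* y → ∃ λ (σ : Permutation′ n) → σ ⟨$⟩ʳ y ≡ x × (∀ z → z ≢ y → z ⟶ (σ ⟨$⟩ʳ z))
    rotation x⟶*y = let σ , σy≡x , σ-edges , _ = rotation-layer n (⟶*⇒∈Reach x⟶*y) in σ , σy≡x , σ-edges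

  OnCycle : Pred (Fin n) ℓ
  OnCycle x = ∃ λ z → z ≢ x × x ⟶* z × z ⟶* x

  onCycle? : Decidable OnCycle
  onCycle? x = any? λ z → ¬? (z ≟ x) ×-dec reachable? x z ×-dec reachable? z x

  last-step : ∀ {x z} → z ≢ x → z ⟶* x → ∃ λ y → y ≢ x × z ⟶* y × y ⟶ x
  last-step z≢x ε = contradiction refl z≢x
  last-step {x} {z} z≢x (_◅_ {j = w} z⟶w w⟶*x) with w ≟ x
  ... | yes refl = z , z≢x , ε , z⟶w
  ... | no  w≢x  = let y , y≢x , w⟶*y , y⟶x = last-step w≢x w⟶*x in y , y≢x , z⟶w ◅ w⟶*y , y⟶x

  onCycle⇒rotation : (∀ z → z ⟶ z) → ∀ {x} → OnCycle x →
    ∃ λ (σ : Permutation′ n) → (∀ z → z ⟶ (σ ⟨$⟩ʳ z)) × σ ⟨$⟩ʳ x ≢ x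
  onCycle⇒rotation loop {x} (z , z≢x , x⟶*z , z⟶*x) with last-step z≢x z⟶*x
  ... | y , y≢x , z⟶*y , y⟶x with rotation loop x (x⟶*z ◅◅ z⟶*y)
  ...   | σ , σy≡x , σ-edges = σ , edges , λ σx≡x → y≢x (permutation-injective σ (trans σy≡x (sym σx≡x)))
    where
    edges : ∀ w → w ⟶ (σ ⟨$⟩ʳ w)
    edges w with w ≟ y
    ... | yes refl = subst (w ⟶_) (sym σy≡x) y⟶x
    ... | no  w≢y  = σ-edges w w≢y

  t<∣Reach∣ : ∀ {t x} → 1 < t → (∀ z → t ≤ ∣ toSubset (z ⟶?_) ∣) → ¬ OnCycle x → t < ∣ Reach x ∣
  t<∣Reach∣ {t} {x} 1<t out-deg off
    with ∣q∣<∣p∣⇒∃∈p∉q {q = ⁅ x ⁆}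
           (subst (_< ∣ toSubset (x ⟶?_) ∣) (sym (∣⁅x⁆∣≡1 x)) (<-≤-trans 1<t (out-deg x)))
  ... | s , s∈Out , s∉⁅x⁆ = begin-strict
    t                         ≤⟨ out-deg s ⟩
    ∣ toSubset (s ⟶?_) ∣      ≤⟨ p⊆q⇒∣p∣≤∣q∣ Out-s⊆Reach-x ⟩
    ∣ Reach x - x ∣           <⟨ x∈p⇒∣p-x∣<∣p∣ (⟶*⇒∈Reach ε) ⟩
    ∣ Reach x ∣               ∎
    where
    open ≤-Reasoning
    x⟶s : x ⟶ s
    x⟶s = ∈-toSubset⁻ (x ⟶?_) s∈Out
    Out-s⊆Reach-x : toSubset (s ⟶?_) ⊆ Reach x - x
    Out-s⊆Reach-x z∈Out with ∈-toSubset⁻ (s ⟶?_) z∈Out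
    ... | s⟶z = x∈p∧x≢y⇒x∈p-y (⟶*⇒∈Reach (x⟶s ◅ s⟶z ◅ ε))
                  (λ { refl → off (s , x∉⁅y⁆⇒x≢y s∉⁅x⁆ , x⟶s ◅ ε , s⟶z ◅ ε) })

module OffCycleBound {_⟶_ : Rel (Fin n) ℓ} (_⟶?_ : B.Decidable _⟶_) {t : ℕ} (1<t : 1 < t)
  (out-deg : ∀ x → t ≤ ∣ toSubset (x ⟶?_) ∣) (in-deg : ∀ x → t ≤ ∣ toSubset (_⟶? x) ∣)
  (n≤2t+2 : n ≤ suc t + suc t) where

  open Digraph _⟶?_
  private module Reversed = Digraph (flip _⟶?_)

  Reach⁻ : Fin n → Subset n
  Reach⁻ = Reversed.Reach

  ⟶*⇒∈Reach⁻ : ∀ {x z} → z ⟶* x → z ∈ Reach⁻ x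
  ⟶*⇒∈Reach⁻ = Reversed.⟶*⇒∈Reach ∘ reverse id

  ∈Reach⁻⇒⟶* : ∀ {x z} → z ∈ Reach⁻ x → z ⟶* x
  ∈Reach⁻⇒⟶* = reverse id ∘ Reversed.∈Reach⇒⟶*

  Incomparable : Fin n → Subset n
  Incomparable x = ∁ (Reach x ∪ Reach⁻ x)

  off-cycle⇒≡ : ∀ {x z} → ¬ OnCycle x → x ⟶* z → z ⟶* x → z ≡ x
  off-cycle⇒≡ {x} {z} off x⟶*z z⟶*x = decidable-stable (z ≟ x) (λ z≢x → off (z , z≢x , x⟶*z , z⟶*x))

  Reach∩Reach⁻≡⁅x⁆ : ∀ {x} → ¬ OnCycle x → Reach x ∩ Reach⁻ x ≡ ⁅ x ⁆
  Reach∩Reach⁻≡⁅x⁆ {x} off = ⊆-antisym ⊆⁅x⁆ ⁅x⁆⊆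
    where
    ⊆⁅x⁆ : Reach x ∩ Reach⁻ x ⊆ ⁅ x ⁆
    ⊆⁅x⁆ z∈ with x∈p∩q⁻ (Reach x) (Reach⁻ x) z∈
    ... | z∈R , z∈R⁻ with off-cycle⇒≡ off (∈Reach⇒⟶* z∈R) (∈Reach⁻⇒⟶* z∈R⁻)
    ...   | refl = x∈⁅x⁆ x
    ⁅x⁆⊆ : ⁅ x ⁆ ⊆ Reach x ∩ Reach⁻ x
    ⁅x⁆⊆ z∈ with x∈⁅y⁆⇒x≡y x z∈
    ... | refl = x∈p∩q⁺ (⟶*⇒∈Reach ε , ⟶*⇒∈Reach⁻ ε)

  t<∣Reach⁻∣ : ∀ {x} → ¬ OnCycle x → t < ∣ Reach⁻ x ∣
  t<∣Reach⁻∣ off = Reversed.t<∣Reach∣ 1<t in-deg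
    (λ (z , z≢x , x⟵*z , z⟵*x) → off (z , z≢x , reverse id z⟵*x , reverse id x⟵*z))

  -- Incomparable x, Reach x and Reach⁻ x - x partition the n ≤ 2t + 2 vertices, and ∣ Reach⁻ x ∣ > t.
  budget : ∀ {x} → ¬ OnCycle x → ∣ Incomparable x ∣ + ∣ Reach x ∣ ≤ 2 + t
  budget {x} off = +-cancelʳ-≤ (suc t) _ _ (begin
    I + R + suc t                     ≤⟨ +-monoʳ-≤ (I + R) (t<∣Reach⁻∣ off) ⟩
    I + R + R⁻                        ≡⟨ +-assoc I R R⁻ ⟩
    I + (R + R⁻)                      ≡⟨ cong (I +_) (∣p∪q∣+∣p∩q∣≡∣p∣+∣q∣ (Reach x) (Reach⁻ x)) ⟨
    I + (U + ∣ Reach x ∩ Reach⁻ x ∣)  ≡⟨ cong (λ k → I + (U + k)) ∣Reach∩Reach⁻∣≡1 ⟩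
    I + (U + 1)                       ≡⟨ +-assoc I U 1 ⟨
    I + U + 1                         ≡⟨ cong (_+ 1) (trans (+-comm I U) (∣p∣+∣∁p∣≡n (Reach x ∪ Reach⁻ x))) ⟩
    n + 1                             ≡⟨ +-comm n 1 ⟩
    suc n                             ≤⟨ s≤s n≤2t+2 ⟩
    2 + t + suc t                     ∎)
    where
    open ≤-Reasoning
    I = ∣ Incomparable x ∣
    R = ∣ Reach x ∣
    R⁻ = ∣ Reach⁻ x ∣
    U = ∣ Reach x ∪ Reach⁻ x ∣
    ∣Reach∩Reach⁻∣≡1 : ∣ Reach x ∩ Reach⁻ x ∣ ≡ 1
    ∣Reach∩Reach⁻∣≡1 = trans (cong ∣_∣ (Reach∩Reach⁻≡⁅x⁆ off)) (∣⁅x⁆∣≡1 x)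

  over-budget : ∀ {x} → ¬ OnCycle x → 3 + t ≤ ∣ Incomparable x ∣ + ∣ Reach x ∣ → ∅
  over-budget off large = <⇒≱ large (budget off)

  Reach-⊂ : ∀ {a b} → ¬ OnCycle a → b ∈ Reach a → b ≢ a → Reach b ⊂ Reach a
  Reach-⊂ off b∈Ra b≢a =
    (λ z∈Rb → ⟶*⇒∈Reach (∈Reach⇒⟶* b∈Ra ◅◅ ∈Reach⇒⟶* z∈Rb)) ,
    _ , ⟶*⇒∈Reach ε , λ a∈Rb → b≢a (off-cycle⇒≡ off (∈Reach⇒⟶* b∈Ra) (∈Reach⇒⟶* a∈Rb))

  descendant⇒1+t<∣Reach∣ : ∀ {a b} → ¬ OnCycle a → ¬ OnCycle b → b ∈ Reach a → b ≢ a → 1 + t < ∣ Reach a ∣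
  descendant⇒1+t<∣Reach∣ off-a off-b b∈Ra b≢a =
    ≤-trans (s≤s (t<∣Reach∣ 1<t out-deg off-b)) (p⊂q⇒∣p∣<∣q∣ (Reach-⊂ off-a b∈Ra b≢a))

  two-descendants⇒2+t<∣Reach∣ : ∀ {a b c} → ¬ OnCycle a → ¬ OnCycle b → ¬ OnCycle c →
    b ∈ Reach a → c ∈ Reach a → b ≢ a → c ≢ a → b ≢ c → 2 + t < ∣ Reach a ∣
  two-descendants⇒2+t<∣Reach∣ {a} {b} {c} off-a off-b off-c b∈Ra c∈Ra b≢a c≢a b≢c with c ∈? Reach b
  ... | yes c∈Rb = ≤-trans (s≤s (descendant⇒1+t<∣Reach∣ off-b off-c c∈Rb (≢-sym b≢c))) (p⊂q⇒∣p∣<∣q∣ Rb⊂Ra)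
    where Rb⊂Ra = Reach-⊂ off-a b∈Ra b≢a
  ... | no  c∉Rb = begin-strict
    2 + t             ≤⟨ s≤s (t<∣Reach∣ 1<t out-deg off-b) ⟩
    suc ∣ Reach b ∣   ≤⟨ p⊂q⇒∣p∣<∣q∣ Rb⊂Ra-c ⟩
    ∣ Reach a - c ∣   <⟨ x∈p⇒∣p-x∣<∣p∣ c∈Ra ⟩
    ∣ Reach a ∣       ∎
    where
    open ≤-Reasoning
    Rb⊂Ra = Reach-⊂ off-a b∈Ra b≢a
    Rb⊂Ra-c : Reach b ⊂ Reach a - c
    Rb⊂Ra-c = (λ z∈Rb → x∈p∧x≢y⇒x∈p-y (proj₁ Rb⊂Ra z∈Rb) (λ { refl → c∉Rb z∈Rb })) ,
              a , x∈p∧x≢y⇒x∈p-y (⟶*⇒∈Reach ε) (≢-sym c≢a) , proj₂ (proj₂ (proj₂ Rb⊂Ra))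

  descendant-and-third⇒absurd : ∀ {a b c} → ¬ OnCycle a → ¬ OnCycle b → ¬ OnCycle c →
    b ∈ Reach a → b ≢ a → c ≢ a → c ≢ b → ∅
  descendant-and-third⇒absurd {a} {b} {c} off-a off-b off-c b∈Ra b≢a c≢a c≢b with c ∈? Incomparable a
  ... | yes c∈I = over-budget off-a (+-mono-≤ (x∈p⇒0<∣p∣ c∈I) (descendant⇒1+t<∣Reach∣ off-a off-b b∈Ra b≢a))
  ... | no  c∉I with x∈p∪q⁻ (Reach a) (Reach⁻ a) (x∉∁p⇒x∈p c∉I)
  ...   | inj₁ c∈Ra  = over-budget off-a (+-mono-≤ z≤n
            (two-descendants⇒2+t<∣Reach∣ off-a off-b off-c b∈Ra c∈Ra b≢a c≢a (≢-sym c≢b)))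
  ...   | inj₂ c∈R⁻a = over-budget off-c (+-mono-≤ z≤n
            (two-descendants⇒2+t<∣Reach∣ off-c off-a off-b
              (⟶*⇒∈Reach c⟶*a) (⟶*⇒∈Reach (c⟶*a ◅◅ ∈Reach⇒⟶* b∈Ra)) (≢-sym c≢a) (≢-sym c≢b) (≢-sym b≢a)))
    where
    c⟶*a = ∈Reach⁻⇒⟶* c∈R⁻a

  comparable-and-third⇒absurd : ∀ {a b c} → ¬ OnCycle a → ¬ OnCycle b → ¬ OnCycle c →
    b ∉ Incomparable a → b ≢ a → c ≢ a → c ≢ b → ∅
  comparable-and-third⇒absurd {a} {b} off-a off-b off-c b∉I b≢a c≢a c≢b
    with x∈p∪q⁻ (Reach a) (Reach⁻ a) (x∉∁p⇒x∈p b∉I)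
  ... | inj₁ b∈Ra  = descendant-and-third⇒absurd off-a off-b off-c b∈Ra b≢a c≢a c≢b
  ... | inj₂ b∈R⁻a =
    descendant-and-third⇒absurd off-b off-a off-c (⟶*⇒∈Reach (∈Reach⁻⇒⟶* b∈R⁻a)) (≢-sym b≢a) c≢b c≢a

  no-three-off-cycle : ∀ {u v w} → ¬ OnCycle u → ¬ OnCycle v → ¬ OnCycle w → u ≢ v → u ≢ w → v ≢ w → ∅
  no-three-off-cycle {u} {v} {w} off-u off-v off-w u≢v u≢w v≢w with v ∈? Incomparable u | w ∈? Incomparable u
  ... | yes v∈I | yes w∈I = over-budget off-u (+-mono-≤ (x≢y⇒1<∣p∣ v∈I w∈I v≢w) (t<∣Reach∣ 1<t out-deg off-u))
  ... | no  v∉I | _       = comparable-and-third⇒absurd off-u off-v off-w v∉I (≢-sym u≢v) (≢-sym u≢w) (≢-sym v≢w)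
  ... | yes _   | no  w∉I = comparable-and-third⇒absurd off-u off-w off-v w∉I (≢-sym u≢w) (≢-sym u≢v) v≢w

  at-most-two-off-cycle : n ≤ 2 + ∣ toSubset onCycle? ∣
  at-most-two-off-cycle = begin
    n                ≡⟨ ∣p∣+∣∁p∣≡n C ⟨
    ∣ C ∣ + ∣ ∁ C ∣  ≤⟨ +-monoʳ-≤ ∣ C ∣ ∣∁C∣≤2 ⟩
    ∣ C ∣ + 2        ≡⟨ +-comm ∣ C ∣ 2 ⟩
    2 + ∣ C ∣        ∎
    where
    open ≤-Reasoning
    C = toSubset onCycle?
    off : ∀ {x} → x ∈ ∁ C → ¬ OnCycle x
    off x∈∁C = x∈∁p⇒x∉p x∈∁C ∘ ∈-toSubset⁺ onCycle?
    ∣∁C∣≤2 : ∣ ∁ C ∣ ≤ 2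
    ∣∁C∣≤2 = no-three-distinct⇒∣p∣≤2 λ x∈ y∈ z∈ → no-three-off-cycle (off x∈) (off y∈) (off z∈)

oneFactor-avoiding : ∀ {s} (H : Bigraph s) (ρ : Permutation′ s) {a b} →
  (∀ z → adj H z (ρ ⟨$⟩ʳ z) ≡ true) → ρ ⟨$⟩ʳ a ≢ b → OneFactor (H -ₑ (a , b))
oneFactor-avoiding H ρ {a} {b} ρ-edges ρa≢b = ρ , avoids
  where
  avoids : ∀ z → adj (H -ₑ (a , b)) z (ρ ⟨$⟩ʳ z) ≡ true
  avoids z with z ≟ a | ρ ⟨$⟩ʳ z ≟ b
  ... | no  _    | _        = trans (∧-identityʳ _) (ρ-edges z)
  ... | yes _    | no  _    = trans (∧-identityʳ _) (ρ-edges z)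
  ... | yes refl | yes ρa≡b = contradiction ρa≡b ρa≢b

all-but-two-edges-removable : ∀ {s t} → 1 < t → s ≤ suc t + suc t →
  (H : Bigraph s) → IsBigraph s t H → (M : OneFactor H) →
  Σ (Subset s) λ M′ → s ≤ 2 + ∣ M′ ∣ × (∀ a → a ∈ M′ → OneFactor (H -ₑ edgeAt H M a))
all-but-two-edges-removable {s} {t} 1<t s≤2t+2 H (degA≥t , degB≥t) (π , π-edges) =
  toSubset onCycle? , at-most-two-off-cycle , removable
  where
  _⟶_ : Rel (Fin s) 0ℓ
  i ⟶ j = T (adj H i (π ⟨$⟩ʳ j))

  _⟶?_ : B.Decidable _⟶_
  i ⟶? j = T? (adj H i (π ⟨$⟩ʳ j))

  out-deg : ∀ i → t ≤ ∣ toSubset (i ⟶?_) ∣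
  out-deg i = ≤-trans (degA≥t i) (≤-reflexive (sym (∣tabulate∘permute∣≡∣tabulate∣ (adj H i) π)))

  in-deg : ∀ j → t ≤ ∣ toSubset (_⟶? j) ∣
  in-deg j = degB≥t (π ⟨$⟩ʳ j)

  open Digraph _⟶?_ using (onCycle?; onCycle⇒rotation)
  open OffCycleBound _⟶?_ 1<t out-deg in-deg s≤2t+2 using (at-most-two-off-cycle)

  removable : ∀ a → a ∈ toSubset onCycle? → OneFactor (H -ₑ (a , π ⟨$⟩ʳ a))
  removable a a∈ with onCycle⇒rotation (Equivalence.from T-≡ ∘ π-edges) (∈-toSubset⁻ onCycle? a∈)
  ... | σ , σ-edges , σa≢a =
    oneFactor-avoiding H (σ ∘ₚ π) (Equivalence.to T-≡ ∘ σ-edges) (σa≢a ∘ permutation-injective π)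

lemma23 : (H : Bigraph 8) → IsBigraph 8 3 H → (M : OneFactor H) →
    Σ (Subset 8) λ M′ → 6 ≤ ∣ M′ ∣ × (∀ a → a ∈ M′ → OneFactor (H -ₑ edgeAt H M a))
lemma23 H deg M = map₂ (map₁ (+-cancelˡ-≤ 2 6 _)) (all-but-two-edges-removable (s≤s (s≤s z≤n)) ≤-refl H deg M)
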